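{- Let $\mathbf{A}$ be an algebra. If a congruence equation fails in $\mathbf{A}$, then it fails in the matrix power $\mathbf{A}^{[2]}$.
   Context: For an algebra $\mathbf{A}$ and $n\ge1$, let $T_n(\mathbf{A})$ be the set of $n$-ary terms in the signature of $\mathbf{A}$. The $2$nd matrix power of $\mathbf{A}$ is the algebra $\mathbf{A}^{[2]}$ with universe $A^2$ whose basic operations are all $m_t$ for $t=\langle t_1,t_2\rangle\in T_{2k}(\mathbf{A})^2$, $k\ge1$, where $m_t(\langle a_{11},a_{12}\rangle,\dots,\langle a_{k1},a_{k2}\rangle)=\langle t_1^{\mathbf{A}}(a_{11},a_{12},\dots,a_{k1},a_{k2}),\,t_2^{\mathbf{A}}(a_{11},a_{12},\dots,a_{k1},a_{k2})\rangle$. A congruence equation is a formal equation between terms in binary symbols $\land,\lor,\circ$. It is satisfied by an algebra $\mathbf{B}$ if it holds whenever its variables are interpreted as congruences of $\mathbf{B}$, with $\alpha\land\beta:=\alpha\cap\beta$, $\alpha\lor\beta:=\Theta^{\mathbf{B}}(\alpha\cup\beta)$ (the congruence of $\mathbf{B}$ generated by $\alpha\cup\beta$) and $\alpha\circ\beta$ the relational product, these operations being applied to arbitrary binary relations on $B$; otherwise it fails in $\mathbf{B}$. -}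

module Defs where

open import Data.Nat using (ℕ; suc; _*_)
open import Data.Fin using (Fin; zero; suc; remQuot)
open import Data.Product using (Σ; _×_; _,_; proj₁; proj₂; ∃)
open import Data.Sum using (_⊎_)
open import Relation.Binary.Core using (Rel)
open import Level using (0ℓ)
open import Relation.Binary.Structures using (IsEquivalence)

record Signature : Set₁ where
  field
    Op    : Set
    arity : Op → ℕ
open Signature public

record Algebra (σ : Signature) : Set₁ where
  field
    Carrier : Set
    op      : (f : Op σ) → (Fin (arity σ f) → Carrier) → Carrier
open Algebra public

data Term (σ : Signature) (n : ℕ) : Set where
  var : Fin n → Term σ n
  app : (f : Op σ) → (Fin (arity σ f) → Term σ n) → Term σ n

⟦_⟧ₜ : {σ : Signature} {n : ℕ} → Term σ n → (𝐀 : Algebra σ) → (Fin n → Carrier 𝐀) → Carrier 𝐀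
⟦ var x ⟧ₜ 𝐀 env = env x
⟦ app f ts ⟧ₜ 𝐀 env = op 𝐀 f (λ i → ⟦ ts i ⟧ₜ 𝐀 env)

-- Second matrix power A^[2]
-- basic operations: m_t for t = ⟨t₁,t₂⟩ ∈ T_{2k}(A)², k ≥ 1 (k = suc k')
MatOp : Signature → Set
MatOp σ = Σ ℕ (λ k' → Term σ (suc k' * 2) × Term σ (suc k' * 2))

MatSig : Signature → Signature
MatSig σ = record { Op = MatOp σ ; arity = λ t → suc (proj₁ t) }

-- variable number 2i+j (j ∈ {0,1}) receives the (j+1)-th coordinate of the (i+1)-th argument
flatten : {A : Set} {k : ℕ} → (Fin k → A × A) → Fin (k * 2) → A
flatten {k = k} args x with remQuot {k} 2 x
... | i , zero  = proj₁ (args i)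
... | i , suc _ = proj₂ (args i)

MatrixPower2 : {σ : Signature} → Algebra σ → Algebra (MatSig σ)
MatrixPower2 {σ} 𝐀 = record
  { Carrier = Carrier 𝐀 × Carrier 𝐀
  ; op = λ { (k' , t₁ , t₂) args →
             ⟦ t₁ ⟧ₜ 𝐀 (flatten args) , ⟦ t₂ ⟧ₜ 𝐀 (flatten args) } }

Compatible : {σ : Signature} (𝐀 : Algebra σ) → Rel (Carrier 𝐀) 0ℓ → Set
Compatible {σ} 𝐀 R = (f : Op σ) (as bs : Fin (arity σ f) → Carrier 𝐀) →
  ((i : Fin (arity σ f)) → R (as i) (bs i)) → R (op 𝐀 f as) (op 𝐀 f bs)

record Congruence {σ : Signature} (𝐀 : Algebra σ) : Set₁ where
  field
    rel        : Rel (Carrier 𝐀) 0ℓ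
    isEquiv    : IsEquivalence rel
    compatible : Compatible 𝐀 rel
open Congruence public

data Θ {σ : Signature} (𝐀 : Algebra σ) (R : Rel (Carrier 𝐀) 0ℓ) : Rel (Carrier 𝐀) 0ℓ where
  base   : ∀ {a b} → R a b → Θ 𝐀 R a b
  θrefl  : ∀ {a} → Θ 𝐀 R a a
  θsym   : ∀ {a b} → Θ 𝐀 R a b → Θ 𝐀 R b a
  θtrans : ∀ {a b c} → Θ 𝐀 R a b → Θ 𝐀 R b c → Θ 𝐀 R a c
  θcompat : (f : Op σ) {as bs : Fin (arity σ f) → Carrier 𝐀} →
            ((i : Fin (arity σ f)) → Θ 𝐀 R (as i) (bs i)) →
            Θ 𝐀 R (op 𝐀 f as) (op 𝐀 f bs)

data CTerm : Set where
  cvar : ℕ → CTerm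
  _∧ᶜ_ _∨ᶜ_ _∘ᶜ_ : CTerm → CTerm → CTerm

⟦_⟧ᶜ : {σ : Signature} {𝐀 : Algebra σ} → CTerm → (ℕ → Congruence 𝐀) → Rel (Carrier 𝐀) 0ℓ
⟦ cvar x ⟧ᶜ ρ = rel (ρ x)
⟦_⟧ᶜ {𝐀 = 𝐀} (p ∧ᶜ q) ρ a b = ⟦ p ⟧ᶜ ρ a b × ⟦ q ⟧ᶜ ρ a b
⟦_⟧ᶜ {𝐀 = 𝐀} (p ∨ᶜ q) ρ = Θ 𝐀 (λ a b → ⟦ p ⟧ᶜ ρ a b ⊎ ⟦ q ⟧ᶜ ρ a b)
⟦_⟧ᶜ {𝐀 = 𝐀} (p ∘ᶜ q) ρ a b = ∃ λ c → ⟦ p ⟧ᶜ ρ a c × ⟦ q ⟧ᶜ ρ c b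

record CongEq : Set where
  constructor _≈ᶜ_
  field
    lhs rhs : CTerm

Satisfies : {σ : Signature} → Algebra σ → CongEq → Set₁
Satisfies 𝐀 (p ≈ᶜ q) = (ρ : ℕ → Congruence 𝐀) → (a b : Carrier 𝐀) →
  (⟦ p ⟧ᶜ ρ a b → ⟦ q ⟧ᶜ ρ a b) × (⟦ q ⟧ᶜ ρ a b → ⟦ p ⟧ᶜ ρ a b)

Fails : {σ : Signature} → Algebra σ → CongEq → Set₁
Fails 𝐀 e = Satisfies 𝐀 e → Data.Empty.⊥
  where import Data.Empty

{-# OPTIONS --safe #-}
-- Squaring congruences, ρ ↦ ρ × ρ, turns a family of congruences of 𝐀 into one of
-- 𝐀^[2], and every congruence term evaluates on the squared family to the square of
-- its value on the original family.  For ∧ and ∘ this is immediate; for ∨ the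
-- nontrivial inclusion Θ(S) × Θ(S) ⊆ Θ(S × S), S reflexive, holds because each translation
-- a ↦ (a , c) carries a basic operation of 𝐀 to one of 𝐀^[2] (a matrix term with c
-- fed in as an extra argument), so it maps generated congruences into generated
-- congruences.  Restricting to the diagonal, an equation holding in 𝐀^[2] holds in 𝐀.
module Submission where

open import Defs
open import Data.Nat using (ℕ; suc)
open import Data.Fin using (Fin; zero; suc; combine; remQuot)
open import Data.Fin.Properties using (remQuot-combine)
open import Data.Product as Product using (_×_; _,_; proj₁; proj₂)
open import Data.Product.Relation.Binary.Pointwise.NonDependent using (Pointwise; ×-isEquivalence)
open import Data.Sum as Sum using (inj₁; inj₂; [_,_])
open import Data.Empty using (⊥)
open import Function using (_∘_; _on_)
open import Level using (0ℓ)
open import Relation.Binary.Core using (Rel; _⇒_)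
open import Relation.Binary.Structures using (IsEquivalence)
import Relation.Binary.Construct.On as On
open import Relation.Binary.PropositionalEquality using (_≡_; refl; sym; _≗_)

module _ {σ : Signature} (𝐀 : Algebra σ) where

  Θ-isEquivalence : (S : Rel (Carrier 𝐀) 0ℓ) → IsEquivalence (Θ 𝐀 S)
  Θ-isEquivalence S = record { refl = θrefl ; sym = θsym ; trans = θtrans }

  Θ-compatible : (S : Rel (Carrier 𝐀) 0ℓ) → Compatible 𝐀 (Θ 𝐀 S)
  Θ-compatible S f _ _ = θcompat f

  Θ-least : {S R : Rel (Carrier 𝐀) 0ℓ} → IsEquivalence R → Compatible 𝐀 R →
    S ⇒ R → Θ 𝐀 S ⇒ R
  Θ-least eq compat S⊆R (base s) = S⊆R s
  Θ-least eq compat S⊆R θrefl = IsEquivalence.refl eq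
  Θ-least eq compat S⊆R (θsym h) = IsEquivalence.sym eq (Θ-least eq compat S⊆R h)
  Θ-least eq compat S⊆R (θtrans h k) =
    IsEquivalence.trans eq (Θ-least eq compat S⊆R h) (Θ-least eq compat S⊆R k)
  Θ-least eq compat S⊆R (θcompat f hs) = compat f _ _ (λ i → Θ-least eq compat S⊆R (hs i))

  -- The least congruence.  It is not provably ≡, since without function
  -- extensionality  op f as ≡ op f bs  does not follow from  as ≗ bs.
  Δ : Rel (Carrier 𝐀) 0ℓ
  Δ = Θ 𝐀 (λ _ _ → ⊥)

  Δ⊆congruence : (C : Congruence 𝐀) → Δ ⇒ rel C
  Δ⊆congruence C = Θ-least (isEquiv C) (compatible C) (λ ())

  Δ-reflexive : _≡_ ⇒ Δ
  Δ-reflexive refl = θrefl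

  Δ-op : (f : Op σ) {as bs : Fin (arity σ f) → Carrier 𝐀} → as ≗ bs → Δ (op 𝐀 f as) (op 𝐀 f bs)
  Δ-op f as≗bs = θcompat f (Δ-reflexive ∘ as≗bs)

  term-compatible : (R : Rel (Carrier 𝐀) 0ℓ) → Compatible 𝐀 R → {n : ℕ} (t : Term σ n)
    {as bs : Fin n → Carrier 𝐀} → (∀ x → R (as x) (bs x)) → R (⟦ t ⟧ₜ 𝐀 as) (⟦ t ⟧ₜ 𝐀 bs)
  term-compatible R compat (var x) h = h x
  term-compatible R compat (app f ts) h = compat f _ _ (λ i → term-compatible R compat (ts i) h)

module _ {A : Set} {k : ℕ} (args : Fin k → A × A) where

  flatten-combine₁ : (i : Fin k) → flatten args (combine i zero) ≡ proj₁ (args i)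
  flatten-combine₁ i rewrite remQuot-combine {k} {2} i zero = refl

  flatten-combine₂ : (i : Fin k) → flatten args (combine i (suc zero)) ≡ proj₂ (args i)
  flatten-combine₂ i rewrite remQuot-combine {k} {2} i (suc zero) = refl

flatten-Pointwise : {A : Set} (R : Rel A 0ℓ) {k : ℕ} {as bs : Fin k → A × A} →
  (∀ i → Pointwise R R (as i) (bs i)) → ∀ x → R (flatten as x) (flatten bs x)
flatten-Pointwise R {k} {as} {bs} h x with remQuot {k} 2 x
... | i , zero = proj₁ (h i)
... | i , suc _ = proj₂ (h i)

module _ {σ : Signature} (𝐀 : Algebra σ) where

  private
    A = Carrier 𝐀
    𝐀² = MatrixPower2 𝐀

  Pointwise-compatible : (R : Rel A 0ℓ) → Compatible 𝐀 R → Compatible 𝐀² (Pointwise R R)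
  Pointwise-compatible R compat (_ , t₁ , t₂) _ _ h =
      term-compatible 𝐀 R compat t₁ (flatten-Pointwise R h)
    , term-compatible 𝐀 R compat t₂ (flatten-Pointwise R h)

  square : Congruence 𝐀 → Congruence 𝐀²
  square C = record
    { rel = Pointwise (rel C) (rel C)
    ; isEquiv = ×-isEquivalence (isEquiv C) (isEquiv C)
    ; compatible = Pointwise-compatible (rel C) (compatible C) }

  Θ-Pointwise⁻ : {S : Rel A 0ℓ} {S² : Rel (A × A) 0ℓ} →
    S² ⇒ Pointwise (Θ 𝐀 S) (Θ 𝐀 S) → Θ 𝐀² S² ⇒ Pointwise (Θ 𝐀 S) (Θ 𝐀 S)
  Θ-Pointwise⁻ {S} = Θ-least 𝐀² (×-isEquivalence (Θ-isEquivalence 𝐀 S) (Θ-isEquivalence 𝐀 S))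
    (Pointwise-compatible (Θ 𝐀 S) (Θ-compatible 𝐀 S))

  -- (op f as , c) is, up to Δ, the value of the basic operation of 𝐀² with
  -- terms ⟨f(x₂,x₄,…), x₁⟩ at ((c , c) , (as 0 , c) , (as 1 , c) , …);
  -- the extra argument (c , c) supplies the constant c and makes the arity positive.
  Θ-on-pairˡ-compatible : {S² : Rel (A × A) 0ℓ} → Pointwise (Δ 𝐀) (Δ 𝐀) ⇒ S² →
    (c : A) → Compatible 𝐀 (Θ 𝐀² S² on (_, c))
  Θ-on-pairˡ-compatible {S²} Δ²⊆S² c f as bs h =
    θtrans (expand as) (θtrans (θcompat m λ { zero → θrefl ; (suc i) → h i }) (θsym (expand bs)))
    where
      n = arity σ f
      m : MatOp σ
      m = n , app f (λ i → var (combine {suc n} {2} (suc i) zero)) , var (combine {suc n} {2} zero (suc zero))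
      args : (Fin n → A) → Fin (suc n) → A × A
      args cs zero = c , c
      args cs (suc i) = cs i , c
      expand : (cs : Fin n → A) → Θ 𝐀² S² (op 𝐀 f cs , c) (op 𝐀² m (args cs))
      expand cs = base (Δ²⊆S²
        ( Δ-op 𝐀 f (λ i → sym (flatten-combine₁ (args cs) (suc i)))
        , Δ-reflexive 𝐀 (sym (flatten-combine₂ (args cs) zero)) ))

  Θ-on-pairʳ-compatible : {S² : Rel (A × A) 0ℓ} → Pointwise (Δ 𝐀) (Δ 𝐀) ⇒ S² →
    (c : A) → Compatible 𝐀 (Θ 𝐀² S² on (c ,_))
  Θ-on-pairʳ-compatible {S²} Δ²⊆S² c f as bs h =
    θtrans (expand as) (θtrans (θcompat m λ { zero → θrefl ; (suc i) → h i }) (θsym (expand bs)))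
    where
      n = arity σ f
      m : MatOp σ
      m = n , var (combine {suc n} {2} zero zero) , app f (λ i → var (combine {suc n} {2} (suc i) (suc zero)))
      args : (Fin n → A) → Fin (suc n) → A × A
      args cs zero = c , c
      args cs (suc i) = c , cs i
      expand : (cs : Fin n → A) → Θ 𝐀² S² (c , op 𝐀 f cs) (op 𝐀² m (args cs))
      expand cs = base (Δ²⊆S²
        ( Δ-reflexive 𝐀 (sym (flatten-combine₁ (args cs) zero))
        , Δ-op 𝐀 f (λ i → sym (flatten-combine₂ (args cs) (suc i))) ))

  Θ-Pointwise⁺ : {S : Rel A 0ℓ} {S² : Rel (A × A) 0ℓ} → Pointwise (Δ 𝐀) (Δ 𝐀) ⇒ S² →
    (∀ {a b} c → S a b → S² (a , c) (b , c)) → (∀ {a b} c → S a b → S² (c , a) (c , b)) →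
    Pointwise (Θ 𝐀 S) (Θ 𝐀 S) ⇒ Θ 𝐀² S²
  Θ-Pointwise⁺ {S} {S²} Δ²⊆S² S⊆S²ˡ S⊆S²ʳ {a , a′} {b , b′} (h , h′) =
    θtrans (Θ-least 𝐀 (equivalence (_, a′)) (Θ-on-pairˡ-compatible Δ²⊆S² a′) (base ∘ S⊆S²ˡ a′) h)
           (Θ-least 𝐀 (equivalence (b ,_)) (Θ-on-pairʳ-compatible Δ²⊆S² b) (base ∘ S⊆S²ʳ b) h′)
    where
      equivalence : (e : A → A × A) → IsEquivalence (Θ 𝐀² S² on e)
      equivalence e = On.isEquivalence e (Θ-isEquivalence 𝐀² S²)

module _ {σ : Signature} {𝐀 : Algebra σ} (ρ : ℕ → Congruence 𝐀) where

  private
    ρ² : ℕ → Congruence (MatrixPower2 𝐀)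
    ρ² = square 𝐀 ∘ ρ

  Δ⊆⟦⟧ᶜ : (p : CTerm) → Δ 𝐀 ⇒ ⟦ p ⟧ᶜ ρ
  Δ⊆⟦⟧ᶜ (cvar n) = Δ⊆congruence 𝐀 (ρ n)
  Δ⊆⟦⟧ᶜ (p ∧ᶜ q) δ = Δ⊆⟦⟧ᶜ p δ , Δ⊆⟦⟧ᶜ q δ
  Δ⊆⟦⟧ᶜ (p ∨ᶜ q) δ = base (inj₁ (Δ⊆⟦⟧ᶜ p δ))
  Δ⊆⟦⟧ᶜ (p ∘ᶜ q) {_} {b} δ = b , Δ⊆⟦⟧ᶜ p δ , Δ⊆⟦⟧ᶜ q θrefl

  ⟦⟧ᶜ-square⁻ : (p : CTerm) → ⟦ p ⟧ᶜ ρ² ⇒ Pointwise (⟦ p ⟧ᶜ ρ) (⟦ p ⟧ᶜ ρ)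
  ⟦⟧ᶜ-square⁻ (cvar n) h = h
  ⟦⟧ᶜ-square⁻ (p ∧ᶜ q) (h , k) = Product.zip _,_ _,_ (⟦⟧ᶜ-square⁻ p h) (⟦⟧ᶜ-square⁻ q k)
  ⟦⟧ᶜ-square⁻ (p ∨ᶜ q) = Θ-Pointwise⁻ 𝐀
    [ Product.map (base ∘ inj₁) (base ∘ inj₁) ∘ ⟦⟧ᶜ-square⁻ p
    , Product.map (base ∘ inj₂) (base ∘ inj₂) ∘ ⟦⟧ᶜ-square⁻ q ]
  ⟦⟧ᶜ-square⁻ (p ∘ᶜ q) ((c₁ , c₂) , h , k) with ⟦⟧ᶜ-square⁻ p h | ⟦⟧ᶜ-square⁻ q k
  ... | h₁ , h₂ | k₁ , k₂ = (c₁ , h₁ , k₁) , (c₂ , h₂ , k₂)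

  ⟦⟧ᶜ-square⁺ : (p : CTerm) → Pointwise (⟦ p ⟧ᶜ ρ) (⟦ p ⟧ᶜ ρ) ⇒ ⟦ p ⟧ᶜ ρ²
  ⟦⟧ᶜ-square⁺ (cvar n) h = h
  ⟦⟧ᶜ-square⁺ (p ∧ᶜ q) ((h₁ , k₁) , (h₂ , k₂)) = ⟦⟧ᶜ-square⁺ p (h₁ , h₂) , ⟦⟧ᶜ-square⁺ q (k₁ , k₂)
  ⟦⟧ᶜ-square⁺ (p ∨ᶜ q) = Θ-Pointwise⁺ 𝐀
    (λ (δ , δ′) → inj₁ (⟦⟧ᶜ-square⁺ p (Δ⊆⟦⟧ᶜ p δ , Δ⊆⟦⟧ᶜ p δ′)))
    (λ _ → Sum.map (λ h → ⟦⟧ᶜ-square⁺ p (h , Δ⊆⟦⟧ᶜ p θrefl)) (λ h → ⟦⟧ᶜ-square⁺ q (h , Δ⊆⟦⟧ᶜ q θrefl)))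
    (λ _ → Sum.map (λ h → ⟦⟧ᶜ-square⁺ p (Δ⊆⟦⟧ᶜ p θrefl , h)) (λ h → ⟦⟧ᶜ-square⁺ q (Δ⊆⟦⟧ᶜ q θrefl , h)))
  ⟦⟧ᶜ-square⁺ (p ∘ᶜ q) ((c₁ , h₁ , k₁) , (c₂ , h₂ , k₂)) =
    (c₁ , c₂) , ⟦⟧ᶜ-square⁺ p (h₁ , h₂) , ⟦⟧ᶜ-square⁺ q (k₁ , k₂)

Satisfies-MatrixPower2⇒Satisfies : {σ : Signature} (𝐀 : Algebra σ) (e : CongEq) →
  Satisfies (MatrixPower2 𝐀) e → Satisfies 𝐀 e
Satisfies-MatrixPower2⇒Satisfies 𝐀 (p ≈ᶜ q) sat ρ a b =
  along-diagonal p q (proj₁ (sat ρ² (a , a) (b , b))) , along-diagonal q p (proj₂ (sat ρ² (a , a) (b , b)))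
  where
    ρ² : ℕ → Congruence (MatrixPower2 𝐀)
    ρ² = square 𝐀 ∘ ρ
    along-diagonal : (p q : CTerm) → (⟦ p ⟧ᶜ ρ² (a , a) (b , b) → ⟦ q ⟧ᶜ ρ² (a , a) (b , b)) →
      ⟦ p ⟧ᶜ ρ a b → ⟦ q ⟧ᶜ ρ a b
    along-diagonal p q p⇒q h = proj₁ (⟦⟧ᶜ-square⁻ ρ q (p⇒q (⟦⟧ᶜ-square⁺ ρ p (h , h))))

corollary3p4 : {σ : Signature} (𝐀 : Algebra σ) (e : CongEq) →
    Fails 𝐀 e → Fails (MatrixPower2 𝐀) e
corollary3p4 𝐀 e fails = fails ∘ Satisfies-MatrixPower2⇒Satisfies 𝐀 e
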